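{- Let $M=\langle W,\succeq,\mathbb{V}\rangle$ be a preference model, $\varphi$ a formula, $rep$ a choice function on nonempty subsets of $W$, $U\subseteq W$, and $B$ a block on $M$ such that $\mathrm{Bet}(w)\subseteq U$ for all $w\in W(B)$. Then the block $\mathrm{antichain}(\mathrm{Sel}(U,\mathrm{Cond}(\varphi)))$ (iv)-covers $B$.
   Context: Formulas are built from $\mathit{Var}$ by $x\mid\neg\psi\mid\psi_1\wedge\psi_2\mid\Box\psi\mid\mathcal{O}(\psi_1\mid\psi_2)$; $\mathrm{Cond}(\varphi)=\{\alpha:\mathcal{O}(\gamma\mid\alpha)\text{ is a subformula of }\varphi\text{ for some }\gamma\}$. A preference model $M=\langle W,\succeq,\mathbb{V}\rangle$ has $W$ nonempty, $\succeq$ any binary relation on $W$, $\mathbb{V}\colon\mathit{Var}\to\mathcal{P}(W)$; $w_1\succ w_2$ iff $w_1\succeq w_2$ and not $w_2\succeq w_1$; $\max_\succ(U)=\{v\in U:\neg\exists u\in U, u\succ v\}$; $\mathrm{Bet}(v)=\{w:w\succ v\}$. Truth sets: $\|x\|=\mathbb{V}(x)$, $\|\neg\psi\|=W\setminus\|\psi\|$, $\|\psi_1\wedge\psi_2\|=\|\psi_1\|\cap\|\psi_2\|$, $\|\Box\beta\|=W$ if $\|\beta\|=W$ else $\emptyset$, $\|\mathcal{O}(\gamma\mid\alpha)\|=W$ if $\max_\succ(\|\alpha\|)\subseteq\|\gamma\|$ else $\emptyset$; $M,w\models\psi$ iff $w\in\|\psi\|$. $\mathrm{SatForm}(M,U)=\{\psi:\exists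 u\in U, M,u\models\psi\}$. $rep$ assigns to each nonempty $S\subseteq W$ an element $rep(S)\in S$. $\mathrm{Sel}(U,\mathcal{A})=\{rep(\|\alpha\|\cap U):\alpha\in\mathcal{A},\ \|\alpha\|\cap U\neq\emptyset\}$. A block on $M$ is a pair $\langle U,\succeq_U\rangle$, $U\subseteq W$, $\succeq_U$ a relation on $U$; $W(\langle U,\succeq_U\rangle)=U$; $\mathrm{antichain}(U)=\langle U,\emptyset\rangle$. A block $B'$ (iv)-covers a block $B$ (relative to $M,\varphi$) if $\mathrm{SatForm}(M,\mathrm{Bet}(w))\cap\mathrm{Cond}(\varphi)\subseteq\mathrm{SatForm}(M,W(B'))$ for every $w\in W(B)$. -}

module Defs where

open import Data.Empty using (⊥)
open import Data.Product using (Σ; ∃; _×_; _,_)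
open import Relation.Nullary using (¬_)
open import Relation.Binary.PropositionalEquality using (_≡_)

data Formula (Var : Set) : Set where
  var  : Var → Formula Var
  ¬ᶠ_  : Formula Var → Formula Var
  _∧ᶠ_ : Formula Var → Formula Var → Formula Var
  □_   : Formula Var → Formula Var
  𝒪[_∣_] : Formula Var → Formula Var → Formula Var

data _⊑_ {Var : Set} : Formula Var → Formula Var → Set where
  ⊑-refl : ∀ {ψ} → ψ ⊑ ψ
  ⊑-¬    : ∀ {ψ φ} → ψ ⊑ φ → ψ ⊑ (¬ᶠ φ)
  ⊑-∧ˡ   : ∀ {ψ φ₁ φ₂} → ψ ⊑ φ₁ → ψ ⊑ (φ₁ ∧ᶠ φ₂)
  ⊑-∧ʳ   : ∀ {ψ φ₁ φ₂} → ψ ⊑ φ₂ → ψ ⊑ (φ₁ ∧ᶠ φ₂)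
  ⊑-□    : ∀ {ψ φ} → ψ ⊑ φ → ψ ⊑ (□ φ)
  ⊑-𝒪ˡ   : ∀ {ψ φ₁ φ₂} → ψ ⊑ φ₁ → ψ ⊑ 𝒪[ φ₁ ∣ φ₂ ]
  ⊑-𝒪ʳ   : ∀ {ψ φ₁ φ₂} → ψ ⊑ φ₂ → ψ ⊑ 𝒪[ φ₁ ∣ φ₂ ]

Cond : {Var : Set} → Formula Var → Formula Var → Set
Cond φ α = ∃ λ γ → 𝒪[ γ ∣ α ] ⊑ φ

record PrefModel (Var : Set) : Set₁ where
  field
    W   : Set
    w₀  : W
    _⪰_ : W → W → Set
    𝕍   : Var → W → Set

module _ {Var : Set} (M : PrefModel Var) where
  open PrefModel M

  _≻_ : W → W → Set
  w₁ ≻ w₂ = (w₁ ⪰ w₂) × ¬ (w₂ ⪰ w₁)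

  Max : (W → Set) → W → Set
  Max U v = U v × ¬ (∃ λ u → U u × (u ≻ v))

  Bet : W → W → Set
  Bet v w = w ≻ v

  _⊨_ : W → Formula Var → Set
  w ⊨ var x      = 𝕍 x w
  w ⊨ (¬ᶠ ψ)     = ¬ (w ⊨ ψ)
  w ⊨ (ψ₁ ∧ᶠ ψ₂) = (w ⊨ ψ₁) × (w ⊨ ψ₂)
  w ⊨ (□ β)      = ∀ v → v ⊨ β
  w ⊨ 𝒪[ γ ∣ α ] = ∀ v → Max (λ u → u ⊨ α) v → v ⊨ γ

  SatForm : (W → Set) → Formula Var → Set
  SatForm U ψ = ∃ λ u → U u × (u ⊨ ψ)

  record ChoiceFn : Set₁ where
    field
      rep   : (W → Set) → W
      rep-∈ : ∀ (S : W → Set) → (∃ λ w → S w) → S (rep S)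

  Sel : ChoiceFn → (W → Set) → (Formula Var → Set) → W → Set
  Sel ch U 𝒜 v = ∃ λ α → 𝒜 α × (∃ λ x → (x ⊨ α) × U x)
                   × (v ≡ ChoiceFn.rep ch (λ x → (x ⊨ α) × U x))

  record Block : Set₁ where
    constructor ⟨_,_⟩
    field
      carrier : W → Set
      rel     : W → W → Set
  open Block public

  WB : Block → W → Set
  WB = carrier

  antichain : (W → Set) → Block
  antichain U = ⟨ U , (λ _ _ → ⊥) ⟩

  IVCovers : Formula Var → Block → Block → Set
  IVCovers φ B′ B = ∀ w → WB B w → ∀ ψ →
    SatForm (Bet w) ψ → Cond φ ψ → SatForm (WB B′) ψ

{-# OPTIONS --safe #-}
module Submission where

open import Defs
open import Data.Product using (_×_; _,_; proj₁)
open import Relation.Binary.PropositionalEquality using (refl)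

module _ {Var : Set} (M : PrefModel Var) where
  open PrefModel M using (W)
  open ChoiceFn using (rep; rep-∈)

  SatForm-mono : {V U : W → Set} → (∀ v → V v → U v) →
                 ∀ {ψ} → SatForm M V ψ → SatForm M U ψ
  SatForm-mono V⊆U (u , u∈V , u⊨ψ) = u , V⊆U u u∈V , u⊨ψ

  SatForm-Sel : (ch : ChoiceFn M) {U : W → Set} {𝒜 : Formula Var → Set} {α : Formula Var} →
                𝒜 α → SatForm M U α → SatForm M (Sel M ch U 𝒜) α
  SatForm-Sel ch {U} {α = α} α∈𝒜 (u , u∈U , u⊨α) =
    rep ch S , (α , α∈𝒜 , (u , u⊨α , u∈U) , refl) , proj₁ (rep-∈ ch S (u , u⊨α , u∈U))
    where
      S : W → Set
      S x = _⊨_ M x α × U x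

lemma3p9 : {Var : Set} (M : PrefModel Var) (φ : Formula Var) (ch : ChoiceFn M)
    (U : PrefModel.W M → Set) (B : Block M) →
    (∀ w → WB M B w → ∀ v → Bet M w v → U v) →
    IVCovers M φ (antichain M (Sel M ch U (Cond φ))) B
lemma3p9 M φ ch U B Bet⊆U w w∈B ψ ψ∈Bet ψ∈Cond =
  SatForm-Sel M ch ψ∈Cond (SatForm-mono M (Bet⊆U w w∈B) {ψ} ψ∈Bet)
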